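{- Let $m,n\in\mathbb{N}$. Let $\mathfrak{a}=(A,=)$ be an antichain on an $m$-element set $A$ and let $\mathfrak{c}=(C,\le)$ be a chain on an $n$-element set $C$ disjoint from $A$, and let $\mathfrak{A\!C}^{\bullet}_{m,n}$ denote the set of proper mergings of $\mathfrak{a}$ and $\mathfrak{c}$. Then \[ \left\lvert\mathfrak{A\!C}^{\bullet}_{m,n}\right\rvert=\sum_{i=1}^{n+1}\Bigl((n+2-i)^{m}-(n+1-i)^{m}\Bigr)i^{m}, \] where, in the case $m=0$, the term $0^0$ is interpreted as $0$.
   Context: An antichain $(A,=)$ is a set ordered by equality. A quasi-order is a reflexive, transitive binary relation. For disjoint quasi-ordered sets $(P,\leftarrow_P)$, $(Q,\leftarrow_Q)$ and relations $R\subseteq P\times Q$, $S\subseteq Q\times P$, define $\leftarrow_{R,S}$ on $P\cup Q$ by: $p\leftarrow_{R,S}q$ iff $p\leftarrow_P q$ or $p\leftarrow_Q q$ or $(p,q)\in R$ or $(p,q)\in S$. $(R,S)$ is a merging of $P$ and $Q$ if $\leftarrow_{R,S}$ is a quasi-order on $P\cup Q$, and a proper merging if additionally $R\cap S^{ -1}=\emptyset$. Mergings are counted as pairs $(R,S)$ of relations. -}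

module Defs where

open import Data.Nat using (ℕ; zero; suc; _^_; _∸_; _*_)
open import Data.Nat.ListAction using (sum)
open import Data.Bool using (Bool; T)
open import Data.Fin using (Fin) renaming (_≤_ to _≤ꟳ_)
open import Data.Vec using (Vec; lookup)
open import Data.List using (List; applyUpTo)
open import Data.Sum using (_⊎_; inj₁; inj₂)
open import Data.Product using (_×_)
open import Relation.Nullary using (¬_)
open import Relation.Binary.PropositionalEquality using (_≡_)

BRel : ℕ → ℕ → Set
BRel k l = Vec (Vec Bool l) k

_∋⟨_,_⟩ : ∀ {k l} → BRel k l → Fin k → Fin l → Set
R ∋⟨ x , y ⟩ = T (lookup (lookup R x) y)

-- The antichain a = (Fin m, ≡) and the chain c = (Fin n, ≤) on disjoint carriers;
-- the union A ∪ C is the disjoint sum Fin m ⊎ Fin n.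
-- ←_{R,S} on A ∪ C for R ⊆ A × C and S ⊆ C × A.
merged : ∀ {m n} → BRel m n → BRel n m → Fin m ⊎ Fin n → Fin m ⊎ Fin n → Set
merged R S (inj₁ a) (inj₁ a′) = a ≡ a′
merged R S (inj₂ c) (inj₂ c′) = c ≤ꟳ c′
merged R S (inj₁ a) (inj₂ c)  = R ∋⟨ a , c ⟩
merged R S (inj₂ c) (inj₁ a)  = S ∋⟨ c , a ⟩

IsMerging : ∀ {m n} → BRel m n → BRel n m → Set
IsMerging {m} {n} R S =
  ((x : Fin m ⊎ Fin n) → merged R S x x) ×
  ((x y z : Fin m ⊎ Fin n) → merged R S x y → merged R S y z → merged R S x z)

IsProperMerging : ∀ {m n} → BRel m n → BRel n m → Set
IsProperMerging {m} {n} R S =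
  IsMerging R S × ((a : Fin m) (c : Fin n) → ¬ (R ∋⟨ a , c ⟩ × S ∋⟨ c , a ⟩))

_^₀_ : ℕ → ℕ → ℕ
zero  ^₀ e = 0
suc b ^₀ e = suc b ^ e

formula : ℕ → ℕ → ℕ
formula m n = sum (applyUpTo term (suc n))
  where
  term : ℕ → ℕ     -- k = i - 1
  term k = (((suc (suc n)) ∸ suc k) ^₀ m ∸ ((suc n) ∸ suc k) ^₀ m) * (suc k ^₀ m)

-- In a proper merging of the antichain A with the chain C, transitivity forces the set of
-- c with a ← c to be an up-set of C and the set of c with c ← a to be a down-set, so a
-- proper merging is determined by thresholds u a (the up-set is [u a, n)) and d a (the
-- down-set is [0, d a)), and it is a proper quasi-order exactly when every d a is at most
-- every u a′. Grouping the pairs (u, d) by k = min u, there are (n+1-k)^m - (n-k)^m choices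
-- of u (with 0^0 = 0 because the minimum of no thresholds is n) and (k+1)^m choices of d.
module Submission where

open import Level using (Level; 0ℓ; _⊔_)
open import Data.Nat using (ℕ; zero; suc; _+_; _*_; _∸_; _^_; _⊓_; _≤_; _<_; z≤n; s≤s; s≤s⁻¹; _≤ᵇ_; _<ᵇ_; _≟_; _≤?_)
open import Data.Nat.Properties
open import Data.Nat.ListAction using (sum)
open import Data.Bool using (true; false; T)
open import Data.Bool.Properties using (T?)
open import Data.Fin using (Fin; zero; suc; toℕ; fromℕ<) renaming (_≤_ to _≤ꟳ_)
open import Data.Fin.Properties using (toℕ-fromℕ<)
open import Data.Vec using (Vec; []; _∷_; lookup; tabulate)
open import Data.Vec.Relation.Binary.Pointwise.Extensional using (ext; Pointwise-≡⇒≡)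
open import Data.Vec.Properties using (∷-injective; lookup∘tabulate)
open import Data.Vec.Relation.Unary.All as Vecᴬ using ([]; _∷_) renaming (All to Allᵛ)
open import Data.Vec.Relation.Unary.All.Properties using (lookup⁺; tabulate⁺)
open import Data.List using (List; []; _∷_; [_]; _++_; map; concatMap; cartesianProduct; filter; upTo; length)
open import Data.List.Properties using (length-++; length-map; length-upTo; map-cong; map-upTo)
open import Data.List.Membership.Propositional using (_∈_; find; lose)
open import Data.List.Membership.Propositional.Properties
  using (∈-map⁺; ∈-map⁻; ∈-++⁺ˡ; ∈-++⁺ʳ; ∈-++⁻; ∈-cartesianProduct⁺; ∈-cartesianProduct⁻)
open import Data.List.Membership.Propositional.Properties
  using (∈-concatMap⁺; ∈-concatMap⁻; ∈-upTo⁺; ∈-upTo⁻; ∈-filter⁺; ∈-filter⁻)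
open import Data.List.Membership.Propositional.Properties.WithK using (unique∧set⇒bag)
open import Data.List.Relation.Unary.Any using (here)
open import Data.List.Relation.Unary.All as Listᴬ using ([]; _∷_)
import Data.List.Relation.Unary.All.Properties as Listᴬ
import Data.List.Relation.Unary.AllPairs as AllPairs
import Data.List.Relation.Unary.AllPairs.Properties as AllPairs
open import Data.List.Relation.Unary.Unique.Propositional using (Unique; []; _∷_)
import Data.List.Relation.Unary.Unique.Propositional.Properties as Unique
open import Data.List.Relation.Binary.BagAndSetEquality using (∼bag⇒↭)
open import Data.List.Relation.Binary.Permutation.Propositional.Properties using (↭-length)
open import Data.Product using (Σ; ∃; _×_; _,_; proj₁; proj₂; uncurry)
open import Data.Sum using (inj₁; inj₂)
open import Data.Empty using (⊥; ⊥-elim)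
open import Function using (_∘_; case_of_)
open import Function.Bundles using (_⇔_; mk⇔; Equivalence)
open import Function.Properties.Equivalence using () renaming (trans to ⇔-trans; sym to ⇔-sym)
open import Relation.Nullary using (¬_; ¬?; yes; no; contradiction)
open import Relation.Nullary.Decidable using (decidable-stable)
open import Relation.Unary using (Pred; Decidable; _∪_; _⟨×⟩_)
open import Relation.Binary.PropositionalEquality using (_≡_; _≢_; refl; sym; trans; cong; cong₂; subst; module ≡-Reasoning)
open import Defs

open Equivalence using (to; from)

private
  variable
    a b i p q : Level
    A : Set a
    B : Set b
    I : Set i
    m n : ℕ

Enumerates : Pred A p → List A → Set _
Enumerates P xs = Unique xs × (∀ x → x ∈ xs ⇔ P x)

record Enumeration {A : Set a} (P : Pred A p) (size : ℕ) : Set (a ⊔ p) where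
  field
    elements        : List A
    enumerates      : Enumerates P elements
    length-elements : length elements ≡ size

open Enumeration

Enumerates-length : ∀ {P : Pred A p} {xs ys} →
  Enumerates P xs → Enumerates P ys → length xs ≡ length ys
Enumerates-length (xs! , xs∈) (ys! , ys∈) =
  ↭-length (∼bag⇒↭ (unique∧set⇒bag xs! ys!
    (mk⇔ (λ x∈xs → from (ys∈ _) (to (xs∈ _) x∈xs)) (λ x∈ys → from (xs∈ _) (to (ys∈ _) x∈ys)))))

Enumerates-resp : ∀ {P : Pred A p} {Q : Pred A q} {xs} →
  (∀ x → P x ⇔ Q x) → Enumerates P xs → Enumerates Q xs
Enumerates-resp P⇔Q (xs! , xs∈) =
  xs! , λ x → mk⇔ (to (P⇔Q x) ∘ to (xs∈ x)) (from (xs∈ x) ∘ from (P⇔Q x))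

Enumerates-[] : ∀ {P : Pred A p} → (∀ x → ¬ P x) → Enumerates P []
Enumerates-[] ¬P = [] , λ x → mk⇔ (λ ()) (⊥-elim ∘ ¬P x)

upTo-enumerates : ∀ n → Enumerates (_< n) (upTo n)
upTo-enumerates n = Unique.upTo⁺ n , λ _ → mk⇔ ∈-upTo⁻ ∈-upTo⁺

Enumerates-map : ∀ {P : Pred A p} {Q : Pred B q} {xs} (f : A → B) →
  (∀ {x} → P x → Q (f x)) →
  (∀ {x y} → P x → P y → f x ≡ f y → x ≡ y) →
  (∀ {y} → Q y → ∃ λ x → P x × f x ≡ y) →
  Enumerates P xs → Enumerates Q (map f xs)
Enumerates-map {P = P} {Q} {xs} f P⇒Q injective surjective (xs! , xs∈) =
  unique (Listᴬ.tabulate (to (xs∈ _))) xs! , members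
  where
  unique : ∀ {ys} → Listᴬ.All P ys → Unique ys → Unique (map f ys)
  unique []         []           = []
  unique (py ∷ pys) (y∉ys ∷ ys!) =
    Listᴬ.map⁺ (Listᴬ.zipWith (λ (y≢z , pz) → y≢z ∘ injective py pz) (y∉ys , pys))
      ∷ unique pys ys!
  members : ∀ y → y ∈ map f xs ⇔ Q y
  members y = mk⇔
    (λ y∈ → let x , x∈xs , y≡fx = ∈-map⁻ f y∈ in subst Q (sym y≡fx) (P⇒Q (to (xs∈ x) x∈xs)))
    (λ qy → let x , px , fx≡y = surjective qy in subst (_∈ map f xs) fx≡y (∈-map⁺ f (from (xs∈ x) px)))

Enumerates-++ : ∀ {P : Pred A p} {Q : Pred A q} {xs ys} →
  (∀ {x} → P x → ¬ Q x) → Enumerates P xs → Enumerates Q ys → Enumerates (P ∪ Q) (xs ++ ys)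
Enumerates-++ {xs = xs} P⇒¬Q (xs! , xs∈) (ys! , ys∈) =
  Unique.++⁺ xs! ys! (λ (x∈xs , x∈ys) → P⇒¬Q (to (xs∈ _) x∈xs) (to (ys∈ _) x∈ys)) ,
  λ x → mk⇔
    (λ x∈ → case ∈-++⁻ xs x∈ of λ where
      (inj₁ x∈xs) → inj₁ (to (xs∈ x) x∈xs)
      (inj₂ x∈ys) → inj₂ (to (ys∈ x) x∈ys))
    (λ where
      (inj₁ px) → ∈-++⁺ˡ (from (xs∈ x) px)
      (inj₂ qx) → ∈-++⁺ʳ xs (from (ys∈ x) qx))

Enumerates-cartesianProduct : ∀ {P : Pred A p} {Q : Pred B q} {xs ys} →
  Enumerates P xs → Enumerates Q ys → Enumerates (P ⟨×⟩ Q) (cartesianProduct xs ys)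
Enumerates-cartesianProduct {xs = xs} {ys} (xs! , xs∈) (ys! , ys∈) =
  Unique.cartesianProduct⁺ xs! ys! ,
  λ (x , y) → mk⇔
    (λ xy∈ → let x∈xs , y∈ys = ∈-cartesianProduct⁻ xs ys xy∈ in to (xs∈ x) x∈xs , to (ys∈ y) y∈ys)
    (λ (px , qy) → ∈-cartesianProduct⁺ (from (xs∈ x) px) (from (ys∈ y) qy))

-- The label of an element tells in which f i it occurs, which makes the f i disjoint.
Enumerates-concatMap : ∀ {K : Pred I q} {P : I → Pred A p} {is f} (label : A → I) →
  (∀ {i x} → P i x → label x ≡ i) →
  Enumerates K is → (∀ i → Enumerates (P i) (f i)) →
  Enumerates (λ x → K (label x) × P (label x) x) (concatMap f is)
Enumerates-concatMap {K = K} {P} {is} {f} label labelled (is! , is∈) f-enum =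
  Unique.concat⁺ (Listᴬ.map⁺ (Listᴬ.tabulate λ {i} _ → proj₁ (f-enum i)))
    (AllPairs.map⁺ (AllPairs.map disjoint is!)) ,
  λ x → mk⇔
    (λ x∈ → let i , i∈is , x∈fi = find (∈-concatMap⁻ f x∈)
                pix = ∈f⇒P x∈fi
            in subst (λ j → K j × P j x) (sym (labelled pix)) (to (is∈ i) i∈is , pix))
    (λ (k , px) → ∈-concatMap⁺ f (lose (from (is∈ _) k) (from (proj₂ (f-enum _) x) px)))
  where
  ∈f⇒P : ∀ {i x} → x ∈ f i → P i x
  ∈f⇒P {i} {x} = to (proj₂ (f-enum i) x)
  disjoint : ∀ {i j} → i ≢ j → ∀ {x} → ¬ (x ∈ f i × x ∈ f j)
  disjoint i≢j (x∈fi , x∈fj) = i≢j (trans (sym (labelled (∈f⇒P x∈fi))) (labelled (∈f⇒P x∈fj)))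

length-cartesianProduct : ∀ (xs : List A) (ys : List B) →
  length (cartesianProduct xs ys) ≡ length xs * length ys
length-cartesianProduct []       ys = refl
length-cartesianProduct (x ∷ xs) ys = begin
  length (map (x ,_) ys ++ cartesianProduct xs ys)          ≡⟨ length-++ (map (x ,_) ys) ⟩
  length (map (x ,_) ys) + length (cartesianProduct xs ys)  ≡⟨ cong₂ _+_ (length-map (x ,_) ys)
                                                                           (length-cartesianProduct xs ys) ⟩
  length ys + length xs * length ys                         ∎
  where open ≡-Reasoning

length-concatMap : ∀ (f : A → List B) xs → length (concatMap f xs) ≡ sum (map (length ∘ f) xs)
length-concatMap f []       = refl
length-concatMap f (x ∷ xs) = trans (length-++ (f x)) (cong (length (f x) +_) (length-concatMap f xs))

range-enumerates : ∀ j l → Enumerates (λ x → j ≤ x × x < j + l) (map (j +_) (upTo l))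
range-enumerates j l =
  Enumerates-map (j +_) (λ {i} i<l → m≤m+n j i , +-monoʳ-< j i<l) (λ _ _ → +-cancelˡ-≡ j _ _)
    (λ {x} (j≤x , x<j+l) → x ∸ j ,
       +-cancelˡ-< j _ _ (subst (_< j + l) (sym (m+[n∸m]≡n j≤x)) x<j+l) , m+[n∸m]≡n j≤x)
    (upTo-enumerates l)

vectors : ∀ m → List A → List (Vec A m)
vectors zero    xs = [ [] ]
vectors (suc m) xs = map (uncurry _∷_) (cartesianProduct xs (vectors m xs))

length-vectors : ∀ m (xs : List A) → length (vectors m xs) ≡ length xs ^ m
length-vectors zero    xs = refl
length-vectors (suc m) xs = begin
  length (map (uncurry _∷_) (cartesianProduct xs (vectors m xs)))
    ≡⟨ length-map (uncurry _∷_) (cartesianProduct xs (vectors m xs)) ⟩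
  length (cartesianProduct xs (vectors m xs))
    ≡⟨ length-cartesianProduct xs (vectors m xs) ⟩
  length xs * length (vectors m xs)
    ≡⟨ cong (length xs *_) (length-vectors m xs) ⟩
  length xs * length xs ^ m
    ∎
  where open ≡-Reasoning

Enumerates-vectors : ∀ {P : Pred A p} {xs} m → Enumerates P xs → Enumerates (Allᵛ P) (vectors m xs)
Enumerates-vectors zero    _    = [] ∷ [] , λ where [] → mk⇔ (λ _ → []) (λ _ → here refl)
Enumerates-vectors (suc m) enum =
  Enumerates-map (uncurry _∷_) (uncurry _∷_)
    (λ _ _ eq → let x≡y , v≡w = ∷-injective eq in cong₂ _,_ x≡y v≡w)
    (λ where (px ∷ pv) → _ , (px , pv) , refl)
    (Enumerates-cartesianProduct enum (Enumerates-vectors m enum))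

minimum : ℕ → Vec ℕ m → ℕ
minimum t []       = t
minimum t (x ∷ xs) = x ⊓ minimum t xs

≤-minimum : ∀ {j} t (xs : Vec ℕ m) → j ≤ minimum t xs ⇔ (j ≤ t × Allᵛ (j ≤_) xs)
≤-minimum t []       = mk⇔ (_, []) proj₁
≤-minimum t (x ∷ xs) = mk⇔
  (λ j≤ → let j≤t , j≤xs = to (≤-minimum t xs) (m≤n⊓o⇒m≤o x _ j≤)
          in j≤t , m≤n⊓o⇒m≤n x _ j≤ ∷ j≤xs)
  (λ where (j≤t , j≤x ∷ j≤xs) → ⊓-glb j≤x (from (≤-minimum t xs) (j≤t , j≤xs)))

minimum-bounds : ∀ t (xs : Vec ℕ m) → minimum t xs ≤ t × Allᵛ (minimum t xs ≤_) xs
minimum-bounds t xs = to (≤-minimum t xs) ≤-refl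

UpClosed : Pred (Fin n) p → Set _
UpClosed P = ∀ {c c′} → c ≤ꟳ c′ → P c → P c′

DownClosed : Pred (Fin n) p → Set _
DownClosed P = ∀ {c c′} → c ≤ꟳ c′ → P c′ → P c

upClosed⇒interval : ∀ {P : Pred (Fin n) p} → Decidable P → UpClosed P →
  ∃ λ u → u ≤ n × (∀ c → P c ⇔ u ≤ toℕ c)
upClosed⇒interval {n = zero}  P? up = 0 , z≤n , λ ()
upClosed⇒interval {n = suc n} P? up with P? zero
... | yes p0 = 0 , z≤n , λ c → mk⇔ (λ _ → z≤n) (λ _ → up z≤n p0)
... | no ¬p0 =
  let u , u≤n , P⇔ = upClosed⇒interval (P? ∘ suc) (λ c≤c′ → up (s≤s c≤c′))
  in suc u , s≤s u≤n , λ where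
       zero    → mk⇔ (λ p0 → contradiction p0 ¬p0) (λ ())
       (suc c) → mk⇔ (s≤s ∘ to (P⇔ c)) (from (P⇔ c) ∘ s≤s⁻¹)

downClosed⇒interval : ∀ {P : Pred (Fin n) p} → Decidable P → DownClosed P →
  ∃ λ d → d ≤ n × (∀ c → P c ⇔ toℕ c < d)
downClosed⇒interval P? down =
  let d , d≤n , ∁P⇔ = upClosed⇒interval (¬? ∘ P?) (λ c≤c′ ¬pc pc′ → ¬pc (down c≤c′ pc′))
  in d , d≤n , λ c → mk⇔
       (λ pc → ≰⇒> (λ d≤c → from (∁P⇔ c) d≤c pc))
       (λ c<d → decidable-stable (P? c) (λ ¬pc → <⇒≱ c<d (to (∁P⇔ c) ¬pc)))

up-⊆⇒≥ : ∀ {u v} → u ≤ n → v ≤ n → (∀ (c : Fin n) → u ≤ toℕ c → v ≤ toℕ c) → v ≤ u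
up-⊆⇒≥ u≤n v≤n ⊆ with m≤n⇒m<n∨m≡n u≤n
... | inj₂ refl = v≤n
... | inj₁ u<n  = subst (_ ≤_) (toℕ-fromℕ< u<n) (⊆ (fromℕ< u<n) (≤-reflexive (sym (toℕ-fromℕ< u<n))))

down-⊆⇒≤ : ∀ {d e} → d ≤ n → (∀ (c : Fin n) → toℕ c < d → toℕ c < e) → d ≤ e
down-⊆⇒≤ {d = zero}  _   _ = z≤n
down-⊆⇒≤ {d = suc d} d<n ⊆ =
  subst (λ x → suc x ≤ _) (toℕ-fromℕ< d<n) (⊆ (fromℕ< d<n) (s≤s (≤-reflexive (toℕ-fromℕ< d<n))))

T-injective : ∀ {b c} → T b ⇔ T c → b ≡ c
T-injective {false} {false} _     = refl
T-injective {false} {true}  T⇔T = ⊥-elim (from T⇔T _)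
T-injective {true}  {false} T⇔T = ⊥-elim (to T⇔T _)
T-injective {true}  {true}  _     = refl

BRel-ext : ∀ {k l} {R R′ : BRel k l} → (∀ x y → R ∋⟨ x , y ⟩ ⇔ R′ ∋⟨ x , y ⟩) → R ≡ R′
BRel-ext R⇔R′ =
  Pointwise-≡⇒≡ (ext λ x → Pointwise-≡⇒≡ (ext λ y → T-injective (R⇔R′ x y)))

lookup∘tabulate² : ∀ {k l} (f : Fin k → Fin l → A) x y →
  lookup (lookup (tabulate (tabulate ∘ f)) x) y ≡ f x y
lookup∘tabulate² f x y =
  trans (cong (λ row → lookup row y) (lookup∘tabulate (tabulate ∘ f) x)) (lookup∘tabulate (f x) y)

-- Proper mergings as threshold vectors

encode : ∀ n → Vec ℕ m × Vec ℕ m → BRel m n × BRel n m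
encode n (u , d) = tabulate (tabulate ∘ λ a c → lookup u a ≤ᵇ toℕ c)
                 , tabulate (tabulate ∘ λ c a → toℕ c <ᵇ lookup d a)

∋-encode₁ : ∀ {u d : Vec ℕ m} a (c : Fin n) → proj₁ (encode n (u , d)) ∋⟨ a , c ⟩ ⇔ lookup u a ≤ toℕ c
∋-encode₁ {u = u} a c = mk⇔ (≤ᵇ⇒≤ _ _ ∘ subst T entry) (subst T (sym entry) ∘ ≤⇒≤ᵇ)
  where entry = lookup∘tabulate² (λ a c → lookup u a ≤ᵇ toℕ c) a c

∋-encode₂ : ∀ {u d : Vec ℕ m} a (c : Fin n) → proj₂ (encode n (u , d)) ∋⟨ c , a ⟩ ⇔ toℕ c < lookup d a
∋-encode₂ {d = d} a c = mk⇔ (<ᵇ⇒< _ _ ∘ subst T entry) (subst T (sym entry) ∘ <⇒<ᵇ)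
  where entry = lookup∘tabulate² (λ c a → toℕ c <ᵇ lookup d a) c a

ProperThresholds : ℕ → Pred (Vec ℕ m × Vec ℕ m) 0ℓ
ProperThresholds n (u , d) = Allᵛ (_≤ n) u × Allᵛ (_≤ minimum n u) d

ProperThresholds⇒bounded : ∀ {u d : Vec ℕ m} → ProperThresholds n (u , d) →
  ∀ a → lookup u a ≤ n × lookup d a ≤ n
ProperThresholds⇒bounded {u = u} (u≤n , d≤min) a =
  lookup⁺ u≤n a , ≤-trans (lookup⁺ d≤min a) (proj₁ (minimum-bounds _ u))

ProperThresholds⇒d≤u : ∀ {u d : Vec ℕ m} → ProperThresholds n (u , d) →
  ∀ a a′ → lookup d a ≤ lookup u a′
ProperThresholds⇒d≤u {u = u} (_ , d≤min) a a′ =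
  ≤-trans (lookup⁺ d≤min a) (lookup⁺ (proj₂ (minimum-bounds _ u)) a′)

encode-proper : ∀ {ud : Vec ℕ m × Vec ℕ m} → ProperThresholds n ud → uncurry IsProperMerging (encode n ud)
encode-proper {m} {n} {u , d} good = (reflexive , transitive) , λ a c (r , s) → no-R∘S r s
  where
  R = proj₁ (encode n (u , d))
  S = proj₂ (encode n (u , d))
  R⇔ : ∀ a c → R ∋⟨ a , c ⟩ ⇔ lookup u a ≤ toℕ c
  R⇔ = ∋-encode₁ {u = u} {d}
  S⇔ : ∀ a c → S ∋⟨ c , a ⟩ ⇔ toℕ c < lookup d a
  S⇔ = ∋-encode₂ {u = u} {d}
  -- u a ≤ c < d a′ ≤ u a is impossible
  no-R∘S : ∀ {a a′ c} → R ∋⟨ a , c ⟩ → S ∋⟨ c , a′ ⟩ → ⊥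
  no-R∘S {a} {a′} {c} r s =
    <-irrefl refl (<-≤-trans (≤-<-trans (to (R⇔ a c) r) (to (S⇔ a′ c) s)) (ProperThresholds⇒d≤u good a′ a))
  reflexive : ∀ x → merged R S x x
  reflexive (inj₁ a) = refl
  reflexive (inj₂ c) = ≤-refl
  transitive : ∀ x y z → merged R S x y → merged R S y z → merged R S x z
  transitive (inj₁ a) (inj₁ _)  (inj₁ _)  refl a≡ = a≡
  transitive (inj₁ a) (inj₁ _)  (inj₂ c)  refl r  = r
  transitive (inj₁ a) (inj₂ c)  (inj₁ a′) r    s  = ⊥-elim (no-R∘S r s)
  transitive (inj₁ a) (inj₂ c)  (inj₂ c′) r    c≤ =
    from (R⇔ a c′) (≤-trans (to (R⇔ a c) r) c≤)
  transitive (inj₂ c) (inj₁ a)  (inj₁ _)  s    refl = s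
  transitive (inj₂ c) (inj₁ a)  (inj₂ c′) s    r  =
    <⇒≤ (<-≤-trans (to (S⇔ a c) s) (≤-trans (ProperThresholds⇒d≤u good a a) (to (R⇔ a c′) r)))
  transitive (inj₂ c) (inj₂ c′) (inj₁ a)  c≤   s  =
    from (S⇔ a c) (≤-<-trans c≤ (to (S⇔ a c′) s))
  transitive (inj₂ c) (inj₂ c′) (inj₂ c″) c≤   c′≤ = ≤-trans c≤ c′≤

encode-injective : ∀ {x y : Vec ℕ m × Vec ℕ m} → ProperThresholds n x → ProperThresholds n y →
  encode n x ≡ encode n y → x ≡ y
encode-injective {m} {n} {u , d} {u′ , d′} good good′ eq =
  cong₂ _,_ (Pointwise-≡⇒≡ (ext same-u)) (Pointwise-≡⇒≡ (ext same-d))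
  where
  transport : (P : BRel m n × BRel n m → Set) → P (encode n (u , d)) ⇔ P (encode n (u′ , d′))
  transport P = mk⇔ (subst P eq) (subst P (sym eq))
  R⇔ : ∀ a c → lookup u a ≤ toℕ c ⇔ lookup u′ a ≤ toℕ c
  R⇔ a c = ⇔-trans (⇔-sym (∋-encode₁ {u = u} {d} a c))
    (⇔-trans (transport (λ RS → proj₁ RS ∋⟨ a , c ⟩)) (∋-encode₁ {u = u′} {d′} a c))
  S⇔ : ∀ a c → toℕ c < lookup d a ⇔ toℕ c < lookup d′ a
  S⇔ a c = ⇔-trans (⇔-sym (∋-encode₂ {u = u} {d} a c))
    (⇔-trans (transport (λ RS → proj₂ RS ∋⟨ c , a ⟩)) (∋-encode₂ {u = u′} {d′} a c))
  bounds  = ProperThresholds⇒bounded good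
  bounds′ = ProperThresholds⇒bounded good′
  same-u : ∀ a → lookup u a ≡ lookup u′ a
  same-u a = ≤-antisym
    (up-⊆⇒≥ (proj₁ (bounds′ a)) (proj₁ (bounds a)) (λ c → from (R⇔ a c)))
    (up-⊆⇒≥ (proj₁ (bounds a)) (proj₁ (bounds′ a)) (λ c → to (R⇔ a c)))
  same-d : ∀ a → lookup d a ≡ lookup d′ a
  same-d a = ≤-antisym
    (down-⊆⇒≤ (proj₂ (bounds a)) (λ c → to (S⇔ a c)))
    (down-⊆⇒≤ (proj₂ (bounds′ a)) (λ c → from (S⇔ a c)))

module _ {R : BRel m n} {S : BRel n m} (merging : IsMerging R S) where

  row-interval : ∀ a → ∃ λ u → u ≤ n × (∀ c → R ∋⟨ a , c ⟩ ⇔ u ≤ toℕ c)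
  row-interval a = upClosed⇒interval (λ c → T? _)
    (λ c≤c′ r → proj₂ merging (inj₁ a) (inj₂ _) (inj₂ _) r c≤c′)

  column-interval : ∀ a → ∃ λ d → d ≤ n × (∀ c → S ∋⟨ c , a ⟩ ⇔ toℕ c < d)
  column-interval a = downClosed⇒interval (λ c → T? _)
    (λ c≤c′ s → proj₂ merging (inj₂ _) (inj₂ _) (inj₁ a) c≤c′ s)

  -- If u a′ < d a, then c = u a′ has a′ ← c ← a, so a′ = a by transitivity, against properness.
  column≤row : (∀ a c → ¬ (R ∋⟨ a , c ⟩ × S ∋⟨ c , a ⟩)) →
    ∀ a a′ → proj₁ (column-interval a) ≤ proj₁ (row-interval a′)
  column≤row proper a a′ = ≮⇒≥ λ u′<d →
    let _ , d≤n , S⇔ = column-interval a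
        _ , _   , R⇔ = row-interval a′
        c = fromℕ< (<-≤-trans u′<d d≤n)
        c≡u′ = toℕ-fromℕ< (<-≤-trans u′<d d≤n)
        r = from (R⇔ c) (≤-reflexive (sym c≡u′))
        s = from (S⇔ c) (subst (_< _) (sym c≡u′) u′<d)
        a′≡a = proj₂ merging (inj₁ a′) (inj₂ c) (inj₁ a) r s
    in proper a c (subst (λ x → R ∋⟨ x , c ⟩) a′≡a r , s)

encode-surjective : ∀ {RS : BRel m n × BRel n m} → uncurry IsProperMerging RS →
  ∃ λ ud → ProperThresholds n ud × encode n ud ≡ RS
encode-surjective {m} {n} {R , S} (merging , proper) =
  (u , d) , good , cong₂ _,_ (BRel-ext R⇔) (BRel-ext S⇔)
  where
  u d : Vec ℕ m
  u = tabulate (proj₁ ∘ row-interval merging)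
  d = tabulate (proj₁ ∘ column-interval merging)
  good : ProperThresholds n (u , d)
  good = tabulate⁺ (proj₁ ∘ proj₂ ∘ row-interval merging)
       , tabulate⁺ (λ a → from (≤-minimum n u)
           (proj₁ (proj₂ (column-interval merging a)) , tabulate⁺ (column≤row merging proper a)))
  R⇔ : ∀ a c → proj₁ (encode n (u , d)) ∋⟨ a , c ⟩ ⇔ R ∋⟨ a , c ⟩
  R⇔ a c = ⇔-trans (∋-encode₁ {u = u} {d} a c)
    (subst (λ x → x ≤ toℕ c ⇔ _) (sym (lookup∘tabulate _ a))
      (⇔-sym (proj₂ (proj₂ (row-interval merging a)) c)))
  S⇔ : ∀ c a → proj₂ (encode n (u , d)) ∋⟨ c , a ⟩ ⇔ S ∋⟨ c , a ⟩
  S⇔ c a = ⇔-trans (∋-encode₂ {u = u} {d} a c)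
    (subst (λ x → toℕ c < x ⇔ _) (sym (lookup∘tabulate _ a))
      (⇔-sym (proj₂ (proj₂ (column-interval merging a)) c)))

^₀≡^ : ∀ {b} e → 0 < b → b ^₀ e ≡ b ^ e
^₀≡^ e (s≤s z≤n) = refl

AtLeast : ℕ → ℕ → Pred (Vec ℕ m) 0ℓ
AtLeast n j u = Allᵛ (_≤ n) u × j ≤ minimum n u

HasMinimum : ℕ → ℕ → Pred (Vec ℕ m) 0ℓ
HasMinimum n k u = Allᵛ (_≤ n) u × minimum n u ≡ k

-- For j > n the count is 0 ^₀ m = 0, even for m = 0: the empty vector has minimum n.
atLeast-enumeration : ∀ m n j → Enumeration (AtLeast {m} n j) ((suc n ∸ j) ^₀ m)
atLeast-enumeration m n j with j ≤? n
... | yes j≤n = record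
  { elements        = vectors m range
  ; enumerates      = Enumerates-resp inRange⇔ (Enumerates-vectors m (range-enumerates j l))
  ; length-elements = len
  }
  where
  l = suc n ∸ j
  range = map (j +_) (upTo l)
  j+l≡1+n : j + l ≡ suc n
  j+l≡1+n = m+[n∸m]≡n (m≤n⇒m≤1+n j≤n)
  <j+l⇔≤n : ∀ {x} → x < j + l ⇔ x ≤ n
  <j+l⇔≤n {x} = mk⇔ (s≤s⁻¹ ∘ subst (x <_) j+l≡1+n) (subst (x <_) (sym j+l≡1+n) ∘ s≤s)
  inRange⇔ : ∀ u → Allᵛ (λ x → j ≤ x × x < j + l) u ⇔ AtLeast n j u
  inRange⇔ u = mk⇔
    (λ inRange → let j≤u , u<j+l = Vecᴬ.unzip inRange
                 in Vecᴬ.map (to <j+l⇔≤n) u<j+l , from (≤-minimum n u) (j≤n , j≤u))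
    (λ (u≤n , j≤min) → Vecᴬ.zip (proj₂ (to (≤-minimum n u) j≤min) , Vecᴬ.map (from <j+l⇔≤n) u≤n))
  len : length (vectors m range) ≡ l ^₀ m
  len = begin
    length (vectors m range)  ≡⟨ length-vectors m range ⟩
    length range ^ m          ≡⟨ cong (_^ m) (trans (length-map (j +_) (upTo l)) (length-upTo l)) ⟩
    l ^ m                     ≡⟨ ^₀≡^ m (m<n⇒0<n∸m (s≤s j≤n)) ⟨
    l ^₀ m                    ∎
    where open ≡-Reasoning
... | no j≰n = record
  { elements        = []
  ; enumerates      = Enumerates-[] (λ u (_ , j≤min) → j≰n (≤-trans j≤min (proj₁ (minimum-bounds n u))))
  ; length-elements = sym (cong (_^₀ m) (m≤n⇒m∸n≡0 (≰⇒> j≰n)))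
  }

atLeast-split : ∀ n k (u : Vec ℕ m) → (HasMinimum n k ∪ AtLeast n (suc k)) u ⇔ AtLeast n k u
atLeast-split n k u = mk⇔
  (λ where (inj₁ (u≤n , min≡k)) → u≤n , ≤-reflexive (sym min≡k)
           (inj₂ (u≤n , k<min)) → u≤n , <⇒≤ k<min)
  (λ (u≤n , k≤min) → case m≤n⇒m<n∨m≡n k≤min of λ where
    (inj₁ k<min) → inj₂ (u≤n , k<min)
    (inj₂ k≡min) → inj₁ (u≤n , sym k≡min))

-- Vectors of minimum k are those of minimum ≥ k without those of minimum ≥ k + 1.
hasMinimum-enumeration : ∀ m n k → Enumeration (HasMinimum {m} n k) ((suc n ∸ k) ^₀ m ∸ (n ∸ k) ^₀ m)
hasMinimum-enumeration m n k = record { elements = us ; enumerates = enum ; length-elements = len }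
  where
  bounded = atLeast-enumeration m n 0
  above = atLeast-enumeration m n (suc k)
  from-k = atLeast-enumeration m n k
  us = filter (λ u → minimum n u ≟ k) (elements bounded)
  enum : Enumerates (HasMinimum n k) us
  enum = Unique.filter⁺ _ (proj₁ (enumerates bounded)) , λ u → mk⇔
    (λ u∈ → let u∈b , min≡k = ∈-filter⁻ _ u∈ in proj₁ (to (proj₂ (enumerates bounded) u) u∈b) , min≡k)
    (λ (u≤n , min≡k) → ∈-filter⁺ _ (from (proj₂ (enumerates bounded) u) (u≤n , z≤n)) min≡k)
  total : length us + length (elements above) ≡ (suc n ∸ k) ^₀ m
  total = begin
    length us + length (elements above)  ≡⟨ length-++ us ⟨
    length (us ++ elements above)        ≡⟨ Enumerates-length
                                           (Enumerates-resp (atLeast-split n k)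
                                             (Enumerates-++ (λ (_ , min≡k) (_ , k<min) → <-irrefl (sym min≡k) k<min)
                                               enum (enumerates above)))
                                           (enumerates from-k) ⟩
    length (elements from-k)          ≡⟨ length-elements from-k ⟩
    (suc n ∸ k) ^₀ m                  ∎
    where open ≡-Reasoning
  len : length us ≡ (suc n ∸ k) ^₀ m ∸ (n ∸ k) ^₀ m
  len = begin
    length us                                             ≡⟨ m+n∸n≡m (length us) (length (elements above)) ⟨
    length us + length (elements above) ∸ length (elements above) ≡⟨ cong₂ _∸_ total (length-elements above) ⟩
    (suc n ∸ k) ^₀ m ∸ (n ∸ k) ^₀ m                       ∎
    where open ≡-Reasoning

properThresholds-enumeration : ∀ m n → Enumeration (ProperThresholds {m} n) (formula m n)
properThresholds-enumeration m n = record
  { elements        = concatMap pairs (upTo (suc n))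
  ; enumerates      = Enumerates-resp properThresholds⇔
      (Enumerates-concatMap (minimum n ∘ proj₁) (proj₂ ∘ proj₁) (upTo-enumerates (suc n))
        (λ k → Enumerates-cartesianProduct (enumerates (minimal k)) (Enumerates-vectors m (upTo-enumerates (suc k)))))
  ; length-elements = len
  }
  where
  minimal = hasMinimum-enumeration m n
  pairs : ℕ → List (Vec ℕ m × Vec ℕ m)
  pairs k = cartesianProduct (elements (minimal k)) (vectors m (upTo (suc k)))
  properThresholds⇔ : ∀ ud → let k = minimum n (proj₁ ud) in
    (k < suc n × (HasMinimum n k ⟨×⟩ Allᵛ (_< suc k)) ud) ⇔ ProperThresholds n ud
  properThresholds⇔ (u , d) = mk⇔
    (λ (_ , (u≤n , _) , d<) → u≤n , Vecᴬ.map s≤s⁻¹ d<)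
    (λ (u≤n , d≤) → s≤s (proj₁ (minimum-bounds n u)) , (u≤n , refl) , Vecᴬ.map s≤s d≤)
  term : ℕ → ℕ
  term k = ((suc n ∸ k) ^₀ m ∸ (n ∸ k) ^₀ m) * suc k ^ m
  count : ∀ k → length (pairs k) ≡ term k
  count k = trans (length-cartesianProduct (elements (minimal k)) (vectors m (upTo (suc k))))
    (cong₂ _*_ (length-elements (minimal k)) (trans (length-vectors m (upTo (suc k))) (cong (_^ m) (length-upTo (suc k)))))
  len : length (concatMap pairs (upTo (suc n))) ≡ formula m n
  len = begin
    length (concatMap pairs (upTo (suc n)))    ≡⟨ length-concatMap pairs (upTo (suc n)) ⟩
    sum (map (length ∘ pairs) (upTo (suc n)))  ≡⟨ cong sum (map-cong count (upTo (suc n))) ⟩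
    sum (map term (upTo (suc n)))              ≡⟨ cong sum (map-upTo term (suc n)) ⟩
    formula m n                                ∎
    where open ≡-Reasoning

theorem5p1 : (m n : ℕ) →
    Σ (List (BRel m n × BRel n m)) λ L →
      Unique L ×
      ((R : BRel m n) (S : BRel n m) → ((R , S) ∈ L) ⇔ IsProperMerging R S) ×
      length L ≡ formula m n
theorem5p1 m n =
  map (encode n) (elements thresholds) , mergings! , (λ R S → mergings∈ (R , S)) ,
  trans (length-map (encode n) (elements thresholds)) (length-elements thresholds)
  where
  thresholds = properThresholds-enumeration m n
  mergings = Enumerates-map {Q = uncurry IsProperMerging} (encode n)
    encode-proper encode-injective encode-surjective (enumerates thresholds)
  mergings! = proj₁ mergings
  mergings∈ = proj₂ mergings
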